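{- Let $L\subseteq\Sigma^*$ be a regular language, $h:\Sigma^*\to M$ a surjective homomorphism onto the syntactic monoid $M$ of $L$, and $F\subseteq M$ with $h^{ -1}(F)=L$. Then $\mathcal{P}(M)/{\sim_F}$ is $\{0,1\}$-free if and only if for all $s,t\in M$ and all idempotents $e\in E(M)$: $st\in F$ implies $set\in F$.
   Context: Syntactic monoid of $L$: $\Sigma^*/{\equiv_L}$ with $u\equiv_L v$ iff $\forall x,y\in\Sigma^*: xuy\in L\Leftrightarrow xvy\in L$. $E(M)$ is the set of idempotents of $M$. $\mathcal{P}(M)=(2^M\setminus\{\emptyset\},\cup,\cdot)$ with $A\cdot B=\{ab\mid a\in A,b\in B\}$. $A_1\sim_F A_2$ iff for all $\ell,r\in M$: $\ell A_1r\cap F\neq\emptyset\iff\ell A_2r\cap F\neq\emptyset$; it is a congruence and $\mathcal{P}(M)/{\sim_F}$ is the quotient semiring. A semiring (commutative semigroup $+$, semigroup $\cdot$, two-sided distributivity, no identities required) is $\{0,1\}$-free if no subsemiring contains an additive identity $0$ and a multiplicative identity $1\neq 0$ of that subsemiring. -}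

module Defs where

open import Level using (0ℓ)
open import Data.Nat using (ℕ)
open import Data.Fin using (Fin)
open import Data.Bool using (Bool; T)
open import Data.List using (List; []; _∷_; _++_; foldl)
open import Data.Product using (Σ; ∃; _×_; _,_)
open import Data.Sum using (_⊎_)
open import Relation.Nullary using (¬_)
open import Function.Bundles using (_⇔_)
open import Algebra.Bundles using (Monoid)

record DFA (A : Set) : Set where
  field
    states : ℕ
    δ      : Fin states → A → Fin states
    start  : Fin states
    final  : Fin states → Bool

  run : Fin states → List A → Fin states
  run = foldl δ

  accepts : List A → Bool
  accepts w = final (run start w)

Language : Set → Set₁
Language A = List A → Set

Regular : {A : Set} → Language A → Set
Regular {A} L = Σ (DFA A) λ D → ∀ w → L w ⇔ T (DFA.accepts D w)

SyntacticEq : {A : Set} → Language A → List A → List A → Set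
SyntacticEq L u v = ∀ x y → L (x ++ u ++ y) ⇔ L (x ++ v ++ y)

module _ {A : Set} (M : Monoid 0ℓ 0ℓ) where
  open Monoid M

  IsHom : (List A → Carrier) → Set
  IsHom h = (h [] ≈ ε) × (∀ u v → h (u ++ v) ≈ h u ∙ h v)

  Surjective : (List A → Carrier) → Set
  Surjective h = ∀ m → ∃ λ w → h w ≈ m

  -- M is the syntactic monoid of L via h: the kernel of h is exactly ≡_L
  -- (together with surjectivity and IsHom: M ≅ A*/≡_L via h)
  KernelIsSyntactic : Language A → (List A → Carrier) → Set
  KernelIsSyntactic L h = ∀ u v → (h u ≈ h v) ⇔ SyntacticEq L u v

module PowerSemiring (M : Monoid 0ℓ 0ℓ) (F : Monoid.Carrier M → Set) where
  open Monoid M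

  record NESubset : Set₁ where
    field
      _∋_   : Carrier → Set
      resp  : ∀ {x y} → x ≈ y → _∋_ x → _∋_ y
      nonempty : ∃ λ x → _∋_ x
  open NESubset public

  infixl 6 _∪_
  infixl 7 _·_

  _∪_ : NESubset → NESubset → NESubset
  (A ∪ B) ∋ x = A ∋ x ⊎ B ∋ x
  resp (A ∪ B) eq (Data.Sum.inj₁ a) = Data.Sum.inj₁ (resp A eq a)
  resp (A ∪ B) eq (Data.Sum.inj₂ b) = Data.Sum.inj₂ (resp B eq b)
  nonempty (A ∪ B) with nonempty A
  ... | x , a = x , Data.Sum.inj₁ a

  _·_ : NESubset → NESubset → NESubset
  (A · B) ∋ m = ∃ λ a → ∃ λ b → A ∋ a × B ∋ b × m ≈ a ∙ b
  resp (A · B) eq (a , b , aA , bB , e) = a , b , aA , bB , trans (sym eq) e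
  nonempty (A · B) with nonempty A | nonempty B
  ... | a , aA | b , bB = a ∙ b , a , b , aA , bB , refl

  Meets : Carrier → NESubset → Carrier → Set
  Meets l A r = ∃ λ a → A ∋ a × F ((l ∙ a) ∙ r)

  _~_ : NESubset → NESubset → Set
  A₁ ~ A₂ = ∀ l r → Meets l A₁ r ⇔ Meets l A₂ r

  -- A subsemiring of the quotient P(M)/~_F, represented as a
  -- ~_F-saturated predicate on P(M) closed under + (∪) and ·.
  record Subsemiring : Set₁ where
    field
      S        : NESubset → Set
      saturated : ∀ {A B} → A ~ B → S A → S B
      +-closed : ∀ {A B} → S A → S B → S (A ∪ B)
      ·-closed : ∀ {A B} → S A → S B → S (A · B)

  HasZeroOne : Subsemiring → Set₁
  HasZeroOne T = Σ NESubset λ z → Σ NESubset λ o →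
      S z × S o
    × (∀ X → S X → ((z ∪ X) ~ X) × ((X ∪ z) ~ X))
    × (∀ X → S X → ((o · X) ~ X) × ((X · o) ~ X))
    × ¬ (o ~ z)
    where open Subsemiring T

  ZeroOneFree : Set₁
  ZeroOneFree = ¬ (Σ Subsemiring HasZeroOne)

IdempotentInsertion : (M : Monoid 0ℓ 0ℓ) → (Monoid.Carrier M → Set) → Set
IdempotentInsertion M F =
  ∀ s t e → e ∙ e ≈ e → F (s ∙ t) → F ((s ∙ e) ∙ t)
  where open Monoid M

module Submission where

-- (⇒) For an idempotent e the sets {e} and {1, e} multiply and add like the
--     Boolean semiring, so their ~_F-saturation is a subsemiring with 0 = {e}
--     and 1 = {1, e}; it is degenerate exactly when s t ∈ F ⇒ s e t ∈ F.
--     Turning "not degenerate" into "s e t ∈ F" uses that F is decidable, which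
--     holds because L is recognised by a DFA.
-- (⇐) In any subsemiring with 0 = z and 1 = o we have z ≲ o because z ∪ o ~ o;
--     conversely a positive power zᵏ contains an idempotent, so idempotent
--     insertion gives o ≲ o · zᵏ ~ zᵏ ≲ z, i.e. o ~ z.  Idempotent powers exist
--     because M is finite: the action of a word on the n states of the DFA is
--     a map Fin n → Fin n, whose n!-th power is idempotent.

open import Level using (0ℓ)
open import Data.Bool using (Bool; true; false; T; _∨_; _∧_)
open import Data.Bool.Properties using (T?; T-∨; T-∧; ∨-identityʳ; ∧-identityʳ)
open import Data.Empty using (⊥-elim)
open import Data.Fin using (Fin; toℕ)
open import Data.Fin.Properties using (pigeonhole; toℕ<n)
open import Data.List using (List; _++_)
open import Data.List.Properties using (foldl-++)
open import Data.Nat using (ℕ; zero; suc; _+_; _*_; _∸_; _≤_; z≤n; s≤s; _!; pred)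
open import Data.Nat.Properties
  using (≤-refl; ≤-trans; <⇒≤; ≤-pred; n<1+n; m∸n≤m; m∸n+n≡m; m<n⇒0<n∸m; +-assoc;
         suc-pred; _!≢0; +-commutativeSemigroup)
open import Data.Nat.Divisibility using (_∣_; quotient; ∣-trans; m∣m*n; ∣⇒≤; m≤n⇒m!∣n!)
open import Data.Product using (∃; _×_; _,_; proj₁; proj₂)
open import Data.Sum using (_⊎_; inj₁; inj₂)
open import Function.Bundles using (_⇔_; mk⇔; Equivalence)
open import Relation.Nullary using (¬_; Dec; yes; no)
open import Relation.Nullary.Decidable using (map′)
open import Algebra.Bundles using (Monoid)
open import Algebra.Properties.CommutativeSemigroup +-commutativeSemigroup using (x∙yz≈y∙xz)
import Relation.Binary.PropositionalEquality as ≡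
open ≡ using (_≡_; cong; cong-app)
open import Defs

module FiniteTransformations where

  -- Every p with 1 ≤ p ≤ n divides n!, since p ∣ p! ∣ n!.
  ∣-factorial : ∀ {p n} → 1 ≤ p → p ≤ n → p ∣ n !
  ∣-factorial {suc p} _ p≤n = ∣-trans (m∣m*n (p !)) (m≤n⇒m!∣n! p≤n)

  -- Needed so that n! lies beyond the tail of every orbit.
  ≤-factorial : ∀ n → n ≤ n !
  ≤-factorial zero    = z≤n
  ≤-factorial (suc n) = ∣⇒≤ {{suc n !≢0}} (∣-factorial (s≤s z≤n) ≤-refl)

  module _ {n : ℕ} (τ : Fin n → Fin n) where
    open import Function.Endo.Propositional (Fin n) using (_^_; ^-homo)
    open ≡.≡-Reasoning

    ^-+ : ∀ i j q → (τ ^ (i + j)) q ≡ (τ ^ i) ((τ ^ j) q)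
    ^-+ i j q = cong-app (^-homo τ i j) q

    -- The orbit of q is ρ-shaped: after a tail of length ≤ n it enters a cycle
    -- whose length is between 1 and n.
    record Lasso (q : Fin n) : Set where
      field
        tail period : ℕ
        period-pos  : 1 ≤ period
        period≤n    : period ≤ n
        tail≤n      : tail ≤ n
        closes      : (τ ^ (period + tail)) q ≡ (τ ^ tail) q

    -- The n+1 points q, τ q, …, τⁿ q of Fin n cannot all be distinct.
    lasso : ∀ q → Lasso q
    lasso q with pigeonhole (n<1+n n) (λ i → (τ ^ toℕ i) q)
    ... | i , j , i<j , same = record
      { tail       = toℕ i
      ; period     = toℕ j ∸ toℕ i
      ; period-pos = m<n⇒0<n∸m i<j
      ; period≤n   = ≤-trans (m∸n≤m (toℕ j) (toℕ i)) j≤n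
      ; tail≤n     = ≤-trans (<⇒≤ i<j) j≤n
      ; closes     = ≡.trans (cong (λ x → (τ ^ x) q) (m∸n+n≡m (<⇒≤ i<j))) (≡.sym same)
      }
      where j≤n = ≤-pred (toℕ<n j)

    recurs : ∀ {q a p m} → (τ ^ (p + a)) q ≡ (τ ^ a) q → a ≤ m →
             (τ ^ (p + m)) q ≡ (τ ^ m) q
    recurs {q} {a} {p} {m} closes a≤m = begin
      (τ ^ (p + m)) q             ≡⟨ cong (λ x → (τ ^ (p + x)) q) (≡.sym (m∸n+n≡m a≤m)) ⟩
      (τ ^ (p + (d + a))) q       ≡⟨ cong (λ x → (τ ^ x) q) (x∙yz≈y∙xz p d a) ⟩
      (τ ^ (d + (p + a))) q       ≡⟨ ^-+ d (p + a) q ⟩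
      (τ ^ d) ((τ ^ (p + a)) q)   ≡⟨ cong (τ ^ d) closes ⟩
      (τ ^ d) ((τ ^ a) q)         ≡⟨ ^-+ d a q ⟨
      (τ ^ (d + a)) q             ≡⟨ cong (λ x → (τ ^ x) q) (m∸n+n≡m a≤m) ⟩
      (τ ^ m) q                   ∎
      where d = m ∸ a

    periodic : ∀ {q a p} → (τ ^ (p + a)) q ≡ (τ ^ a) q →
               ∀ c m → a ≤ m → (τ ^ (c * p + m)) q ≡ (τ ^ m) q
    periodic closes zero    m a≤m = ≡.refl
    periodic {q} {a} {p} closes (suc c) m a≤m = begin
      (τ ^ (p + c * p + m)) q        ≡⟨ cong (λ x → (τ ^ x) q) (+-assoc p (c * p) m) ⟩
      (τ ^ (p + (c * p + m))) q      ≡⟨ ^-+ p (c * p + m) q ⟩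
      (τ ^ p) ((τ ^ (c * p + m)) q)  ≡⟨ cong (τ ^ p) (periodic closes c m a≤m) ⟩
      (τ ^ p) ((τ ^ m) q)            ≡⟨ ^-+ p m q ⟨
      (τ ^ (p + m)) q                ≡⟨ recurs {p = p} closes a≤m ⟩
      (τ ^ m) q                      ∎

    -- τ^(n!) is idempotent: n! exceeds every tail and is a multiple of every period.
    factorial-idempotent : ∀ q → (τ ^ (n !)) ((τ ^ (n !)) q) ≡ (τ ^ (n !)) q
    factorial-idempotent q = begin
      (τ ^ (n !)) ((τ ^ (n !)) q)  ≡⟨ ^-+ (n !) (n !) q ⟨
      (τ ^ (n ! + n !)) q          ≡⟨ cong (λ x → (τ ^ (x + n !)) q) (_∣_.equality period∣n!) ⟩
      (τ ^ (c * period + n !)) q   ≡⟨ periodic closes c (n !) (≤-trans tail≤n (≤-factorial n)) ⟩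
      (τ ^ (n !)) q                ∎
      where
        open Lasso (lasso q)
        period∣n! = ∣-factorial period-pos period≤n
        c = quotient period∣n!

    idempotent-power : ∃ λ k → ∀ q → (τ ^ suc k) ((τ ^ suc k) q) ≡ (τ ^ suc k) q
    idempotent-power =
      pred (n !) ,
      ≡.subst (λ K → ∀ q → (τ ^ K) ((τ ^ K) q) ≡ (τ ^ K) q)
              (≡.sym (suc-pred (n !) {{n !≢0}})) factorial-idempotent

open FiniteTransformations using (idempotent-power)

-- Positive powers with respect to any binary operation: power⁺ _∙_ x k = x^(k+1).
power⁺ : ∀ {a} {X : Set a} → (X → X → X) → X → ℕ → X
power⁺ _∙_ x zero    = x
power⁺ _∙_ x (suc k) = power⁺ _∙_ x k ∙ x

HasIdempotentPowers : Monoid 0ℓ 0ℓ → Set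
HasIdempotentPowers M = ∀ x → ∃ λ k → let e = power⁺ _∙_ x k in e ∙ e ≈ e
  where open Monoid M

module PowerSemiringFacts (M : Monoid 0ℓ 0ℓ) (F : Monoid.Carrier M → Set)
                          (F-resp : ∀ {x y} → Monoid._≈_ M x y → F x → F y) where
  open Monoid M
  open PowerSemiring M F

  -- A ≲ B: every context ℓ _ r in which A meets F is one in which B meets F;
  -- ~_F is exactly the equivalence induced by this preorder.
  infix 4 _≲_
  record _≲_ (A B : NESubset) : Set where
    constructor mk≲
    field meets : ∀ l r → Meets l A r → Meets l B r
  open _≲_

  ≲-refl : ∀ {A} → A ≲ A
  ≲-refl = mk≲ λ _ _ m → m

  ≲-trans : ∀ {A B C} → A ≲ B → B ≲ C → A ≲ C
  ≲-trans A≲B B≲C = mk≲ λ l r m → meets B≲C l r (meets A≲B l r m)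

  ⊆⇒≲ : ∀ {A B} → (∀ x → A ∋ x → B ∋ x) → A ≲ B
  ⊆⇒≲ A⊆B = mk≲ λ { l r (x , x∈A , Flxr) → x , A⊆B x x∈A , Flxr }

  ∪-mono : ∀ {A A′ B B′} → A ≲ A′ → B ≲ B′ → A ∪ B ≲ A′ ∪ B′
  ∪-mono A≲A′ B≲B′ = mk≲ λ where
    l r (x , inj₁ x∈A , Flxr) → let y , y∈A′ , Flyr = meets A≲A′ l r (x , x∈A , Flxr)
                                in y , inj₁ y∈A′ , Flyr
    l r (x , inj₂ x∈B , Flxr) → let y , y∈B′ , Flyr = meets B≲B′ l r (x , x∈B , Flxr)
                                in y , inj₂ y∈B′ , Flyr

  shift-right : ∀ l a b r → (l ∙ (a ∙ b)) ∙ r ≈ (l ∙ a) ∙ (b ∙ r)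
  shift-right l a b r = trans (∙-congʳ (sym (assoc l a b))) (assoc (l ∙ a) b r)

  shift-left : ∀ l a b r → (l ∙ (a ∙ b)) ∙ r ≈ ((l ∙ a) ∙ b) ∙ r
  shift-left l a b r = ∙-congʳ (sym (assoc l a b))

  ·-monoˡ : ∀ {A A′ B} → A ≲ A′ → A · B ≲ A′ · B
  ·-monoˡ A≲A′ = mk≲ λ where
    l r (x , (a , b , a∈A , b∈B , x≈ab) , Flxr) →
      let a′ , a′∈A′ , F = meets A≲A′ l (b ∙ r)
                             (a , a∈A , F-resp (trans (∙-congʳ (∙-congˡ x≈ab)) (shift-right l a b r)) Flxr)
      in a′ ∙ b , (a′ , b , a′∈A′ , b∈B , refl) , F-resp (sym (shift-right l a′ b r)) F

  ·-monoʳ : ∀ {A B B′} → B ≲ B′ → A · B ≲ A · B′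
  ·-monoʳ B≲B′ = mk≲ λ where
    l r (x , (a , b , a∈A , b∈B , x≈ab) , Flxr) →
      let b′ , b′∈B′ , F = meets B≲B′ (l ∙ a) r
                             (b , b∈B , F-resp (trans (∙-congʳ (∙-congˡ x≈ab)) (shift-left l a b r)) Flxr)
      in a ∙ b′ , (a , b′ , a∈A , b′∈B′ , refl) , F-resp (sym (shift-left l a b′ r)) F

  -- A ≃ B is A ~_F B presented as mutual ≲; unlike _~_ it is a record type,
  -- so A and B can be inferred from a proof of it.
  infix 4 _≃_
  record _≃_ (A B : NESubset) : Set where
    constructor _⇄_
    field
      ≲→ : A ≲ B
      ≲← : B ≲ A
  open _≃_

  ≃⇒~ : ∀ {A B} → A ≃ B → A ~ B
  ≃⇒~ (A≲B ⇄ B≲A) l r = mk⇔ (meets A≲B l r) (meets B≲A l r)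

  ~⇒≃ : ∀ {A B} → A ~ B → A ≃ B
  ~⇒≃ A~B = mk≲ (λ l r → Equivalence.to (A~B l r)) ⇄ mk≲ (λ l r → Equivalence.from (A~B l r))

  ≃-refl : ∀ {A} → A ≃ A
  ≃-refl = ≲-refl ⇄ ≲-refl

  ≃-reflexive : ∀ {A B} → A ≡.≡ B → A ≃ B
  ≃-reflexive ≡.refl = ≃-refl

  ≃-sym : ∀ {A B} → A ≃ B → B ≃ A
  ≃-sym (A≲B ⇄ B≲A) = B≲A ⇄ A≲B

  ≃-trans : ∀ {A B C} → A ≃ B → B ≃ C → A ≃ C
  ≃-trans (A≲B ⇄ B≲A) (B≲C ⇄ C≲B) = ≲-trans A≲B B≲C ⇄ ≲-trans C≲B B≲A

  same-elements : ∀ {A B} → (∀ x → A ∋ x → B ∋ x) → (∀ x → B ∋ x → A ∋ x) → A ≃ B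
  same-elements A⊆B B⊆A = ⊆⇒≲ A⊆B ⇄ ⊆⇒≲ B⊆A

  ∪-cong : ∀ {A A′ B B′} → A ≃ A′ → B ≃ B′ → A ∪ B ≃ A′ ∪ B′
  ∪-cong A≃A′ B≃B′ = ∪-mono (≲→ A≃A′) (≲→ B≃B′) ⇄ ∪-mono (≲← A≃A′) (≲← B≃B′)

  ·-cong : ∀ {A A′ B B′} → A ≃ A′ → B ≃ B′ → A · B ≃ A′ · B′
  ·-cong {A} {A′} {B} {B′} A≃A′ B≃B′ =
    ≲-trans (·-monoˡ {B = B} (≲→ A≃A′)) (·-monoʳ {A = A′} (≲→ B≃B′)) ⇄
    ≲-trans (·-monoˡ {B = B′} (≲← A≃A′)) (·-monoʳ {A = A} (≲← B≃B′))

  -- If a Bool-indexed family of subsets realises the Boolean semiring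
  -- ({0,1}, ∨, ∧) up to ~_F and ⟦ true ⟧ ≁ ⟦ false ⟧, then the ~_F-saturation of
  -- its image is a subsemiring with zero ⟦ false ⟧ and identity ⟦ true ⟧, so
  -- P(M)/~_F is not {0,1}-free.
  boolean-image : (⟦_⟧ : Bool → NESubset) →
                  (∀ b c → ⟦ b ⟧ ∪ ⟦ c ⟧ ≃ ⟦ b ∨ c ⟧) →
                  (∀ b c → ⟦ b ⟧ · ⟦ c ⟧ ≃ ⟦ b ∧ c ⟧) →
                  ¬ (⟦ true ⟧ ≃ ⟦ false ⟧) → ¬ ZeroOneFree
  boolean-image ⟦_⟧ ∪-table ·-table distinct free =
    free ( image , ⟦ false ⟧ , ⟦ true ⟧ , (false , ≃-refl) , (true , ≃-refl)
         , zero-law , one-law , λ 1~0 → distinct (~⇒≃ 1~0) )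
    where
      InImage : NESubset → Set
      InImage X = ∃ λ b → X ≃ ⟦ b ⟧

      image : Subsemiring
      image = record
        { S         = InImage
        ; saturated = λ A~B (b , A≃b) → b , ≃-trans (≃-sym (~⇒≃ A~B)) A≃b
        ; +-closed  = λ (b , A≃b) (c , B≃c) → b ∨ c , ≃-trans (∪-cong A≃b B≃c) (∪-table b c)
        ; ·-closed  = λ (b , A≃b) (c , B≃c) → b ∧ c , ≃-trans (·-cong A≃b B≃c) (·-table b c)
        }

      zero-law : ∀ X → InImage X → ((⟦ false ⟧ ∪ X) ~ X) × ((X ∪ ⟦ false ⟧) ~ X)
      zero-law X (b , X≃b) = ≃⇒~ left , ≃⇒~ right
        where
          left : ⟦ false ⟧ ∪ X ≃ X
          left = ≃-trans (∪-cong ≃-refl X≃b) (≃-trans (∪-table false b) (≃-sym X≃b))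
          right : X ∪ ⟦ false ⟧ ≃ X
          right = ≃-trans (∪-cong X≃b ≃-refl)
                    (≃-trans (∪-table b false)
                      (≃-trans (≃-reflexive (≡.cong ⟦_⟧ (∨-identityʳ b))) (≃-sym X≃b)))

      one-law : ∀ X → InImage X → ((⟦ true ⟧ · X) ~ X) × ((X · ⟦ true ⟧) ~ X)
      one-law X (b , X≃b) = ≃⇒~ left , ≃⇒~ right
        where
          left : ⟦ true ⟧ · X ≃ X
          left = ≃-trans (·-cong (≃-refl {⟦ true ⟧}) X≃b) (≃-trans (·-table true b) (≃-sym X≃b))
          right : X · ⟦ true ⟧ ≃ X
          right = ≃-trans (·-cong X≃b (≃-refl {⟦ true ⟧}))
                    (≃-trans (·-table b true)
                      (≃-trans (≃-reflexive (≡.cong ⟦_⟧ (∧-identityʳ b))) (≃-sym X≃b)))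

  -- For an idempotent e, the sets {e} and {1, e} form such a Boolean family:
  -- ⟨e⟩ b is {e}, together with 1 exactly when b is true.
  module IdempotentPair (e : Carrier) (idem : e ∙ e ≈ e) where

    ⟨e⟩ : Bool → NESubset
    ⟨e⟩ b ∋ x = x ≈ e ⊎ (T b × x ≈ ε)
    resp (⟨e⟩ b) y≈x (inj₁ y≈e)        = inj₁ (trans (sym y≈x) y≈e)
    resp (⟨e⟩ b) y≈x (inj₂ (tb , y≈ε)) = inj₂ (tb , trans (sym y≈x) y≈ε)
    nonempty (⟨e⟩ b) = e , inj₁ refl

    ∪-table : ∀ b c → ⟨e⟩ b ∪ ⟨e⟩ c ≃ ⟨e⟩ (b ∨ c)
    ∪-table b c = same-elements join split
      where
        join : ∀ x → (⟨e⟩ b ∪ ⟨e⟩ c) ∋ x → ⟨e⟩ (b ∨ c) ∋ x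
        join x (inj₁ (inj₁ x≈e))        = inj₁ x≈e
        join x (inj₁ (inj₂ (tb , x≈ε))) = inj₂ (Equivalence.from T-∨ (inj₁ tb) , x≈ε)
        join x (inj₂ (inj₁ x≈e))        = inj₁ x≈e
        join x (inj₂ (inj₂ (tc , x≈ε))) = inj₂ (Equivalence.from (T-∨ {b}) (inj₂ tc) , x≈ε)
        split : ∀ x → ⟨e⟩ (b ∨ c) ∋ x → (⟨e⟩ b ∪ ⟨e⟩ c) ∋ x
        split x (inj₁ x≈e) = inj₁ (inj₁ x≈e)
        split x (inj₂ (tb∨c , x≈ε)) with Equivalence.to (T-∨ {b}) tb∨c
        ... | inj₁ tb = inj₁ (inj₂ (tb , x≈ε))
        ... | inj₂ tc = inj₂ (inj₂ (tc , x≈ε))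

    ·-table : ∀ b c → ⟨e⟩ b · ⟨e⟩ c ≃ ⟨e⟩ (b ∧ c)
    ·-table b c = same-elements multiply factor
      where
        product : ∀ {a a′} → ⟨e⟩ b ∋ a → ⟨e⟩ c ∋ a′ → ⟨e⟩ (b ∧ c) ∋ (a ∙ a′)
        product (inj₁ a≈e)        (inj₁ a′≈e)         = inj₁ (trans (∙-cong a≈e a′≈e) idem)
        product (inj₁ a≈e)        (inj₂ (_ , a′≈ε))   = inj₁ (trans (∙-cong a≈e a′≈ε) (identityʳ e))
        product (inj₂ (_ , a≈ε))  (inj₁ a′≈e)         = inj₁ (trans (∙-cong a≈ε a′≈e) (identityˡ e))
        product (inj₂ (tb , a≈ε)) (inj₂ (tc , a′≈ε))  =
          inj₂ (Equivalence.from T-∧ (tb , tc) , trans (∙-cong a≈ε a′≈ε) (identityˡ ε))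
        multiply : ∀ x → (⟨e⟩ b · ⟨e⟩ c) ∋ x → ⟨e⟩ (b ∧ c) ∋ x
        multiply x (a , a′ , a∈ , a′∈ , x≈aa′) = resp (⟨e⟩ (b ∧ c)) (sym x≈aa′) (product a∈ a′∈)
        factor : ∀ x → ⟨e⟩ (b ∧ c) ∋ x → (⟨e⟩ b · ⟨e⟩ c) ∋ x
        factor x (inj₁ x≈e) = e , e , inj₁ refl , inj₁ refl , trans x≈e (sym idem)
        factor x (inj₂ (tb∧c , x≈ε)) =
          let tb , tc = Equivalence.to (T-∧ {b}) tb∧c
          in ε , ε , inj₂ (tb , refl) , inj₂ (tc , refl) , trans x≈ε (sym (identityˡ ε))

  -- (⇒) If s t ∈ F but s e t ∉ F, then {e} and {1, e} are ~_F-distinct, so they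
  -- span a {0,1}-subsemiring.  Deciding membership in F turns this into a proof.
  ZeroOneFree⇒IdempotentInsertion : (∀ m → Dec (F m)) → ZeroOneFree → IdempotentInsertion M F
  ZeroOneFree⇒IdempotentInsertion F? free s t e idem Fst with F? ((s ∙ e) ∙ t)
  ... | yes Fset = Fset
  ... | no ¬Fset = ⊥-elim (boolean-image ⟨e⟩ ∪-table ·-table distinct free)
    where
      open IdempotentPair e idem
      distinct : ¬ (⟨e⟩ true ≃ ⟨e⟩ false)
      distinct 1≃0
        with meets (≲→ 1≃0) s t (ε , inj₂ (_ , refl) , F-resp (∙-congʳ (sym (identityʳ s))) Fst)
      ... | x , inj₁ x≈e , Fsxt = ¬Fset (F-resp (∙-congʳ (∙-congˡ x≈e)) Fsxt)

  insertion-≲ : IdempotentInsertion M F → ∀ {A E e} → E ∋ e → e ∙ e ≈ e → A ≲ A · E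
  insertion-≲ insert {A} {E} {e} e∈E idem = mk≲ λ where
    l r (a , a∈A , Flar) →
      a ∙ e , (a , e , a∈A , e∈E , refl)
            , F-resp (∙-congʳ (assoc l a e)) (insert (l ∙ a) r e idem Flar)

  -- (⇐) In a subsemiring with zero z and identity o we always have z ≲ o; powers of z
  -- contain idempotents, so idempotent insertion gives o ≲ o · zᵏ ≃ zᵏ ≲ z.
  IdempotentInsertion⇒ZeroOneFree : HasIdempotentPowers M → IdempotentInsertion M F → ZeroOneFree
  IdempotentInsertion⇒ZeroOneFree powers insert (T , z , o , z∈T , o∈T , zero-law , one-law , o≁z) =
    o≁z (≃⇒~ (o≲z ⇄ z≲o))
    where
      open Subsemiring T
      z≲o : z ≲ o
      z≲o = ≲-trans (⊆⇒≲ {z} {z ∪ o} (λ _ → inj₁)) (≲→ (~⇒≃ (proj₁ (zero-law o o∈T))))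

      z^ : ℕ → NESubset
      z^ = power⁺ _·_ z

      z^∈T : ∀ k → S (z^ k)
      z^∈T zero    = z∈T
      z^∈T (suc k) = ·-closed (z^∈T k) z∈T

      z^≲z : ∀ k → z^ k ≲ z
      z^≲z zero    = ≲-refl
      z^≲z (suc k) = ≲-trans (·-monoʳ {A = z^ k} z≲o)
                       (≲-trans (≲→ (~⇒≃ (proj₂ (one-law _ (z^∈T k))))) (z^≲z k))

      b = proj₁ (nonempty z)

      b^∈z^ : ∀ k → z^ k ∋ power⁺ _∙_ b k
      b^∈z^ zero    = proj₂ (nonempty z)
      b^∈z^ (suc k) = _ , _ , b^∈z^ k , proj₂ (nonempty z) , refl

      k = proj₁ (powers b)

      o≲z : o ≲ z
      o≲z = ≲-trans (insertion-≲ insert {A = o} {E = z^ k} (b^∈z^ k) (proj₂ (powers b)))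
                    (≲-trans (≲→ (~⇒≃ (proj₁ (one-law _ (z^∈T k))))) (z^≲z k))

module SyntacticMonoidOfDFA {A : Set} {L : Language A} (D : DFA A)
                            (recognises : ∀ w → L w ⇔ T (DFA.accepts D w))
                            (M : Monoid 0ℓ 0ℓ) (h : List A → Monoid.Carrier M) where
  open DFA D
  open Monoid M
  open import Function.Endo.Propositional (Fin states) using (_^_)

  action : List A → Fin states → Fin states
  action w q = run q w

  run-power : ∀ w k q → run q (power⁺ _++_ w k) ≡ (action w ^ suc k) q
  run-power w zero    q = ≡.refl
  run-power w (suc k) q =
    ≡.trans (foldl-++ δ q (power⁺ _++_ w k) w) (≡.cong (action w) (run-power w k q))

  same-action⇒syntactic : ∀ {u v} → (∀ q → run q u ≡ run q v) → SyntacticEq L u v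
  same-action⇒syntactic {u} {v} same x y =
    mk⇔ (λ Lxuy → Equivalence.from (recognises _)
                    (≡.subst T accepts-same (Equivalence.to (recognises _) Lxuy)))
        (λ Lxvy → Equivalence.from (recognises _)
                    (≡.subst T (≡.sym accepts-same) (Equivalence.to (recognises _) Lxvy)))
    where
      open ≡.≡-Reasoning
      run-in-context : ∀ w → run start (x ++ w ++ y) ≡ run (run (run start x) w) y
      run-in-context w = ≡.trans (foldl-++ δ start x (w ++ y)) (foldl-++ δ (run start x) w y)
      accepts-same : accepts (x ++ u ++ y) ≡ accepts (x ++ v ++ y)
      accepts-same = ≡.cong final (begin
        run start (x ++ u ++ y)          ≡⟨ run-in-context u ⟩
        run (run (run start x) u) y      ≡⟨ ≡.cong (λ q → run q y) (same (run start x)) ⟩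
        run (run (run start x) v) y      ≡⟨ run-in-context v ⟨
        run start (x ++ v ++ y)          ∎)

  decidable : Surjective M h → (F : Carrier → Set) → (∀ {x y} → x ≈ y → F x → F y) →
              (∀ w → F (h w) ⇔ L w) → ∀ m → Dec (F m)
  decidable surjective F F-resp F↔L m =
    let w , hw≈m = surjective m in
    map′ (λ acc → F-resp hw≈m (Equivalence.from (F↔L w) (Equivalence.from (recognises w) acc)))
         (λ Fm → Equivalence.to (recognises w) (Equivalence.to (F↔L w) (F-resp (sym hw≈m) Fm)))
         (T? (accepts w))

  h-power : IsHom M h → ∀ {w x} → h w ≈ x → ∀ k → h (power⁺ _++_ w k) ≈ power⁺ _∙_ x k
  h-power _          hw≈x zero    = hw≈x
  h-power hom@(_ , h-++) {w} hw≈x (suc k) =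
    trans (h-++ (power⁺ _++_ w k) w) (∙-cong (h-power hom hw≈x k) hw≈x)

  idempotent-action : ∀ w k →
    (∀ q → (action w ^ suc k) ((action w ^ suc k) q) ≡ (action w ^ suc k) q) →
    let u = power⁺ _++_ w k in ∀ q → run q (u ++ u) ≡ run q u
  idempotent-action w k idem q = begin
    run q (u ++ u)               ≡⟨ foldl-++ δ q u u ⟩
    run (run q u) u              ≡⟨ run-power w k (run q u) ⟩
    (τ ^ suc k) (run q u)        ≡⟨ ≡.cong (τ ^ suc k) (run-power w k q) ⟩
    (τ ^ suc k) ((τ ^ suc k) q)  ≡⟨ idem q ⟩
    (τ ^ suc k) q                ≡⟨ run-power w k q ⟨
    run q u                      ∎
    where
      open ≡.≡-Reasoning
      τ = action w
      u = power⁺ _++_ w k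

  -- The syntactic monoid of L has idempotent powers: for x = h w, an idempotent
  -- power of the action of w yields one of x.
  idempotent-powers : IsHom M h → Surjective M h → KernelIsSyntactic M L h → HasIdempotentPowers M
  idempotent-powers hom surjective kernel x = k , (begin
      e ∙ e       ≈⟨ ∙-cong hu≈e hu≈e ⟨
      h u ∙ h u   ≈⟨ proj₂ hom u u ⟨
      h (u ++ u)  ≈⟨ Equivalence.from (kernel (u ++ u) u) (same-action⇒syntactic uu-acts-as-u) ⟩
      h u         ≈⟨ hu≈e ⟩
      e           ∎)
    where
      open import Relation.Binary.Reasoning.Setoid setoid
      w = proj₁ (surjective x)
      k = proj₁ (idempotent-power (action w))
      u = power⁺ _++_ w k
      e = power⁺ _∙_ x k

      hu≈e : h u ≈ e
      hu≈e = h-power hom (proj₂ (surjective x)) k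

      uu-acts-as-u : ∀ q → run q (u ++ u) ≡ run q u
      uu-acts-as-u = idempotent-action w k (proj₂ (idempotent-power (action w)))

proposition6p8 :
    (k : ℕ) (L : List (Fin k) → Set) → Regular L →
    (M : Monoid 0ℓ 0ℓ) (h : List (Fin k) → Monoid.Carrier M) →
    IsHom M h → Surjective M h → KernelIsSyntactic M L h →
    (F : Monoid.Carrier M → Set) →
    (∀ {x y} → Monoid._≈_ M x y → F x → F y) →
    (∀ w → F (h w) ⇔ L w) →
    PowerSemiring.ZeroOneFree M F ⇔ IdempotentInsertion M F
proposition6p8 k L (D , recognises) M h hom surjective kernel F F-resp F↔L =
  mk⇔ (ZeroOneFree⇒IdempotentInsertion (decidable surjective F F-resp F↔L))
      (IdempotentInsertion⇒ZeroOneFree (idempotent-powers hom surjective kernel))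
  where
    open PowerSemiringFacts M F F-resp
    open SyntacticMonoidOfDFA D recognises M h
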